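{- Let $\Delta$ be a bi-transitive bipartite digraph containing no two (distinct) equivalent vertices. Then for every vertex $u$ of $\Delta$ there is at most one vertex $v$ such that both $uv$ and $vu$ are edges of $\Delta$.
   Context: Digraphs have no loops or multiple edges; $N(u)$, $N^-(u)$ denote out- and in-neighbourhoods. A bipartite digraph has two colour classes with every edge joining different classes; it is bi-transitive if whenever $u_1v_1,v_1u_2,u_2v_2$ are edges, $u_1v_2$ is an edge. Vertices $x,y$ are equivalent if $N(x)=N(y)$ and $N^-(x)=N^-(y)$. -}

module Defs where

open import Level using (Level; suc; _⊔_)
open import Data.Bool using (Bool)
open import Data.Product using (_×_; Σ)
open import Relation.Binary.PropositionalEquality using (_≡_)
open import Relation.Nullary using (¬_)
open import Function.Bundles using (_⇔_)

-- A digraph: a vertex type with an irreflexive edge relation E (E u v means uv is an edge).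
-- Multiple edges are excluded automatically since E is a relation.
record Digraph (a ℓ : Level) : Set (suc (a ⊔ ℓ)) where
  field
    V      : Set a
    E      : V → V → Set ℓ
    noLoop : ∀ v → ¬ E v v
open Digraph public

Bipartite : ∀ {a ℓ} → Digraph a ℓ → Set (a ⊔ ℓ)
Bipartite Δ = Σ (V Δ → Bool) λ c → ∀ u v → E Δ u v → ¬ (c u ≡ c v)

BiTransitive : ∀ {a ℓ} → Digraph a ℓ → Set (a ⊔ ℓ)
BiTransitive Δ = ∀ u₁ v₁ u₂ v₂ → E Δ u₁ v₁ → E Δ v₁ u₂ → E Δ u₂ v₂ → E Δ u₁ v₂

Equivalent : ∀ {a ℓ} (Δ : Digraph a ℓ) → V Δ → V Δ → Set (a ⊔ ℓ)
Equivalent Δ x y = (∀ w → E Δ x w ⇔ E Δ y w) × (∀ w → E Δ w x ⇔ E Δ w y)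

NoEquivalentPair : ∀ {a ℓ} → Digraph a ℓ → Set (a ⊔ ℓ)
NoEquivalentPair Δ = ∀ x y → Equivalent Δ x y → x ≡ y

-- If v and w both lie on 2-cycles through u, then any path x → v → u → w collapses
-- to an edge x → w by bi-transitivity, and symmetrically for out-edges and with v, w
-- swapped; so v and w are equivalent, hence equal.
module Submission where

open import Defs
open import Data.Product using (_×_; _,_)
open import Relation.Binary.PropositionalEquality using (_≡_)
open import Function.Bundles using (mk⇔)

module _ {a ℓ} (Δ : Digraph a ℓ) (bt : BiTransitive Δ) where

  two-cycles-through-same-vertex⇒equivalent :
    ∀ {u v w} → E Δ u v × E Δ v u → E Δ u w × E Δ w u → Equivalent Δ v w
  two-cycles-through-same-vertex⇒equivalent {u} {v} {w} (uv , vu) (uw , wu) =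
    (λ x → mk⇔ (λ vx → bt w u v x wu uv vx) (λ wx → bt v u w x vu uw wx)) ,
    (λ x → mk⇔ (λ xv → bt x v u w xv vu uw) (λ xw → bt x w u v xw wu uv))

lemma4 : ∀ {a ℓ} (Δ : Digraph a ℓ) → Bipartite Δ → BiTransitive Δ → NoEquivalentPair Δ →
    ∀ (u v w : V Δ) → (E Δ u v × E Δ v u) → (E Δ u w × E Δ w u) → v ≡ w
lemma4 Δ _ bt noPair u v w uv↔ uw↔ =
  noPair v w (two-cycles-through-same-vertex⇒equivalent Δ bt uv↔ uw↔)
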